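{- For every positive integer $m$, \[ g(2m)=4g(m),\qquad g(2m+1)=g(m)+g(m+1). \]
   Context: For a positive integer $m$, the chocolate game $C_{m,m}$ is a two-player impartial game on an $m\times m$ chocolate bar of unit cells, exactly one of which is poisoned (known to both players); cells are $(i,j)$ with $1\le i,j\le m$. Players alternately break the current bar along a grid line into two rectangular pieces, eat one and pass the other (always keeping the poisoned cell); a player who receives the $1\times1$ bar loses. A cell is a P-position if with poison there the second player has a winning strategy; $P_{m,m}$ is the set of P-positions. It is known that $(i,j)\in P_{m,m}$ iff $(i-1)\oplus(j-1)\oplus(m-i)\oplus(m-j)=0$ ($\oplus$ = bitwise XOR). Define $g(m)=\#P_{m,m}$. -}

module Defs where

open import Data.Nat using (ℕ; zero; suc; _+_; _*_; _∸_; _≟_)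
open import Data.Nat.DivMod using (_/_; _%_)
open import Data.List using (List; length; filter; cartesianProduct)
open import Data.List.Base using (upTo)
open import Data.Product using (_×_; _,_)
open import Relation.Binary.PropositionalEquality using (_≡_)
open import Relation.Nullary using (Dec)

-- Bitwise XOR on natural numbers, computed with a fuel parameter that
-- bounds the number of binary digits processed (fuel ≥ a + b suffices).
xorFuel : ℕ → ℕ → ℕ → ℕ
xorFuel zero    a b = 0
xorFuel (suc f) a b =
  (if-bit (a % 2) (b % 2)) + 2 * xorFuel f (a / 2) (b / 2)
  where
  if-bit : ℕ → ℕ → ℕ
  if-bit zero    zero    = 0
  if-bit zero    (suc _) = 1
  if-bit (suc _) zero    = 1
  if-bit (suc _) (suc _) = 0

_⊕_ : ℕ → ℕ → ℕ
a ⊕ b = xorFuel (a + b) a b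

infixl 6 _⊕_

-- Cell (i , j), 1 ≤ i, j ≤ m, is a P-position of C_{m,m} iff
-- (i-1) ⊕ (j-1) ⊕ (m-i) ⊕ (m-j) = 0.
IsP : ℕ → ℕ × ℕ → Set
IsP m (i , j) = ((i ∸ 1) ⊕ (j ∸ 1) ⊕ (m ∸ i) ⊕ (m ∸ j)) ≡ 0

IsP? : (m : ℕ) → (c : ℕ × ℕ) → Dec (IsP m c)
IsP? m (i , j) = ((i ∸ 1) ⊕ (j ∸ 1) ⊕ (m ∸ i) ⊕ (m ∸ j)) ≟ 0

cells1 : ℕ → List ℕ
cells1 m = Data.List.map suc (upTo m)

board : ℕ → List (ℕ × ℕ)
board m = cartesianProduct (cells1 m) (cells1 m)

g : ℕ → ℕ
g m = length (filter (IsP? m) (board m))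

-- With 0-based rows, cell (a + 1 , c + 1) is a P-position iff v a ≡ v c for the row value
-- v a = a ⊕ (m - 1 - a), so g m counts the pairs of rows with equal value.  Splitting the
-- rows of a board of size 2m by parity, the values are 2 v_m a + 1, each taken twice: this
-- gives the factor 4.  For size 2m + 1 the values are 2 v_{m+1} a and 2 v_m a, and since
-- v_m a has the parity of m - 1, a value from v_{m+1} never equals a value from v_m.
module Submission where

open import Defs
open import Data.Nat using (ℕ; suc; _+_; _*_)
open import Data.Product using (_×_)
open import Relation.Binary.PropositionalEquality using (_≡_)

open import Algebra.Bundles using (AbelianGroup)
open import Algebra.Structures using (IsAbelianGroup)
import Algebra.Properties.CommutativeSemigroup as CommutativeSemigroupProperties
import Algebra.Properties.Group as GroupProperties
open import Data.Bool.Base using (true; false; if_then_else_)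
open import Data.List.Base using (List; map; applyUpTo; cartesianProduct; length; filter)
open import Data.List.Properties using (filter-++; length-++; map-applyUpTo)
open import Data.Nat.Base using (zero; _∸_; _≤_; _<_; z≤n; s≤s; parity; ⌊_/2⌋)
open import Data.Nat.DivMod using (_/_; _%_; m/n≡1+[m∸n]/n; m/n*n≤m)
open import Data.Nat.Induction using (<-rec)
open import Data.Nat.Properties
  using (+-identityʳ; +-assoc; +-comm; *-distribˡ-+; *-distribʳ-+; ≤-trans; ≤-refl;
         _≟_; suc-injective; n≤1+n; m≤m*n; *-zeroʳ; ≤-reflexive; +-mono-≤; m+[n∸m]≡n; ⌊n/2⌋<n;
         +-commutativeSemigroup)
open import Data.Parity.Base as ℙ using (Parity; 0ℙ; 1ℙ; _⁻¹)
import Data.Parity.Properties as ℙ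
open import Data.Product using (_,_)
open import Function.Base using (id; _∘_)
open import Function.Bundles using (_⇔_; mk⇔; Equivalence)
open import Function.Definitions using (Injective)
open import Relation.Binary.PropositionalEquality
  using (refl; sym; trans; cong; cong₂; subst; _≢_; isEquivalence; module ≡-Reasoning)
open import Relation.Nullary.Decidable using (Dec; does; does-⇔; dec-false)
open import Relation.Unary using (Decidable)

open ≡-Reasoning
open CommutativeSemigroupProperties +-commutativeSemigroup using () renaming (interchange to +-interchange)

double : ℕ → ℕ
double zero    = zero
double (suc n) = suc (suc (double n))

double≡2* : ∀ n → double n ≡ 2 * n
double≡2* zero    = refl
double≡2* (suc n) = begin
  suc (suc (double n)) ≡⟨ cong (suc ∘ suc) (double≡2* n) ⟩
  suc (suc (2 * n))    ≡⟨ sym (*-distribˡ-+ 2 1 n) ⟩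
  2 * suc n            ∎

double-∸ : ∀ m n → double m ∸ double n ≡ double (m ∸ n)
double-∸ zero    zero    = refl
double-∸ zero    (suc n) = refl
double-∸ (suc m) zero    = refl
double-∸ (suc m) (suc n) = double-∸ m n

double-∸-suc : ∀ {m n} → n < m → double m ∸ suc (double n) ≡ suc (double (m ∸ suc n))
double-∸-suc {suc m} {zero}  _         = refl
double-∸-suc {suc m} {suc n} (s≤s n<m) = double-∸-suc n<m

infix 8 _·2+_

_·2+_ : ℕ → Parity → ℕ
h ·2+ 0ℙ = double h
h ·2+ 1ℙ = suc (double h)

toℕ : Parity → ℕ
toℕ p = 0 ·2+ p

·2+≡ : ∀ h p → h ·2+ p ≡ toℕ p + 2 * h
·2+≡ h 0ℙ = double≡2* h
·2+≡ h 1ℙ = cong suc (double≡2* h)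

parity-·2+ : ∀ h p → parity (h ·2+ p) ≡ p
parity-·2+ zero    0ℙ = refl
parity-·2+ zero    1ℙ = refl
parity-·2+ (suc h) 0ℙ = parity-·2+ h 0ℙ
parity-·2+ (suc h) 1ℙ = parity-·2+ h 1ℙ

·2+-%2 : ∀ h p → (h ·2+ p) % 2 ≡ toℕ p
·2+-%2 zero    0ℙ = refl
·2+-%2 zero    1ℙ = refl
·2+-%2 (suc h) 0ℙ = ·2+-%2 h 0ℙ
·2+-%2 (suc h) 1ℙ = ·2+-%2 h 1ℙ

suc-suc-/2 : ∀ n → suc (suc n) / 2 ≡ suc (n / 2)
suc-suc-/2 n = m/n≡1+[m∸n]/n {suc (suc n)} {2} (s≤s (s≤s z≤n))

·2+-/2 : ∀ h p → (h ·2+ p) / 2 ≡ h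
·2+-/2 zero    0ℙ = refl
·2+-/2 zero    1ℙ = refl
·2+-/2 (suc h) 0ℙ = trans (suc-suc-/2 (double h)) (cong suc (·2+-/2 h 0ℙ))
·2+-/2 (suc h) 1ℙ = trans (suc-suc-/2 (suc (double h))) (cong suc (·2+-/2 h 1ℙ))

⌊n/2⌋·2+parity≡n : ∀ n → ⌊ n /2⌋ ·2+ parity n ≡ n
⌊n/2⌋·2+parity≡n zero          = refl
⌊n/2⌋·2+parity≡n (suc zero)    = refl
⌊n/2⌋·2+parity≡n (suc (suc n)) =
  trans (suc-·2+ ⌊ n /2⌋ (parity n)) (cong (suc ∘ suc) (⌊n/2⌋·2+parity≡n n))
  where
  suc-·2+ : ∀ h p → suc h ·2+ p ≡ suc (suc (h ·2+ p))
  suc-·2+ h 0ℙ = refl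
  suc-·2+ h 1ℙ = refl

data Bits : ℕ → Set where
  []  : Bits 0
  _∷_ : ∀ p {h} → Bits h → Bits (h ·2+ p)

bits : ∀ n → Bits n
bits = <-rec Bits go
  where
  go : ∀ n → (∀ {k} → k < n → Bits k) → Bits n
  go zero    _   = []
  go (suc n) rec = subst Bits (⌊n/2⌋·2+parity≡n (suc n)) (parity (suc n) ∷ rec (⌊n/2⌋<n n))

xorFuel-0-0 : ∀ F → xorFuel F 0 0 ≡ 0
xorFuel-0-0 zero    = refl
xorFuel-0-0 (suc F) = cong (2 *_) (xorFuel-0-0 F)

halves-+-≤ : ∀ u v {F} → u + v ≤ suc F → u / 2 + v / 2 ≤ F
halves-+-≤ u v {F} u+v≤1+F = half-≤ (≤-trans (≤-reflexive (*-distribʳ-+ 2 (u / 2) (v / 2)))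
  (≤-trans (+-mono-≤ (m/n*n≤m u 2) (m/n*n≤m v 2)) u+v≤1+F))
  where
  half-≤ : ∀ {x} → x * 2 ≤ suc F → x ≤ F
  half-≤ {zero}  _             = z≤n
  half-≤ {suc x} (s≤s 1+2x≤F) = ≤-trans (s≤s (m≤m*n x 2)) 1+2x≤F

xorFuel-irrelevant : ∀ {F F′} u v → u + v ≤ F → u + v ≤ F′ → xorFuel F u v ≡ xorFuel F′ u v
xorFuel-irrelevant {zero}  {zero}   u       v       _ _ = refl
xorFuel-irrelevant {zero}  {suc F′} zero    zero    _ _ = sym (xorFuel-0-0 (suc F′))
xorFuel-irrelevant {suc F} {zero}   zero    zero    _ _ = xorFuel-0-0 (suc F)
xorFuel-irrelevant {suc F} {suc F′} u       v       ≤F ≤F′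
  rewrite xorFuel-irrelevant {F} {F′} (u / 2) (v / 2) (halves-+-≤ u v ≤F) (halves-+-≤ u v ≤F′) = refl

-- The low bit of xorFuel is computed by a function local to Defs, so it is only
-- evaluated on concrete digits.
xorFuel-suc-·2+ : ∀ F x y p q →
  xorFuel (suc F) (x ·2+ p) (y ·2+ q) ≡ toℕ (p ℙ.+ q) + 2 * xorFuel F ((x ·2+ p) / 2) ((y ·2+ q) / 2)
xorFuel-suc-·2+ F x y 0ℙ 0ℙ rewrite ·2+-%2 x 0ℙ | ·2+-%2 y 0ℙ = refl
xorFuel-suc-·2+ F x y 0ℙ 1ℙ rewrite ·2+-%2 x 0ℙ | ·2+-%2 y 1ℙ = refl
xorFuel-suc-·2+ F x y 1ℙ 0ℙ rewrite ·2+-%2 x 1ℙ | ·2+-%2 y 0ℙ = refl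
xorFuel-suc-·2+ F x y 1ℙ 1ℙ rewrite ·2+-%2 x 1ℙ | ·2+-%2 y 1ℙ = refl

⊕-·2+ : ∀ x y p q → (x ·2+ p) ⊕ (y ·2+ q) ≡ (x ⊕ y) ·2+ (p ℙ.+ q)
⊕-·2+ x y p q = begin
  u ⊕ v                                        ≡⟨ xorFuel-irrelevant u v ≤-refl (n≤1+n (u + v)) ⟩
  xorFuel (suc (u + v)) u v                    ≡⟨ xorFuel-suc-·2+ (u + v) x y p q ⟩
  toℕ r + 2 * xorFuel (u + v) (u / 2) (v / 2)  ≡⟨ cong (λ z → toℕ r + 2 * z) halves-fuel ⟩
  toℕ r + 2 * ((u / 2) ⊕ (v / 2))              ≡⟨ cong (λ z → toℕ r + 2 * z) (cong₂ _⊕_ (·2+-/2 x p) (·2+-/2 y q)) ⟩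
  toℕ r + 2 * (x ⊕ y)                          ≡⟨ sym (·2+≡ (x ⊕ y) r) ⟩
  (x ⊕ y) ·2+ r                                ∎
  where
  u = x ·2+ p
  v = y ·2+ q
  r = p ℙ.+ q
  halves-fuel : xorFuel (u + v) (u / 2) (v / 2) ≡ (u / 2) ⊕ (v / 2)
  halves-fuel = xorFuel-irrelevant (u / 2) (v / 2) (halves-+-≤ u v (n≤1+n (u + v))) ≤-refl

⊕-identityˡ : ∀ x → 0 ⊕ x ≡ x
⊕-identityˡ x = go (bits x)
  where
  go : ∀ {x} → Bits x → 0 ⊕ x ≡ x
  go []      = refl
  go (p ∷ b) = trans (⊕-·2+ 0 _ 0ℙ p) (cong (_·2+ p) (go b))

⊕-identityʳ : ∀ x → x ⊕ 0 ≡ x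
⊕-identityʳ x = go (bits x)
  where
  go : ∀ {x} → Bits x → x ⊕ 0 ≡ x
  go []      = refl
  go (p ∷ b) = trans (⊕-·2+ _ 0 p 0ℙ) (cong₂ _·2+_ (go b) (ℙ.+-identityʳ p))

x⊕x≡0 : ∀ x → x ⊕ x ≡ 0
x⊕x≡0 x = go (bits x)
  where
  go : ∀ {x} → Bits x → x ⊕ x ≡ 0
  go []      = refl
  go (p ∷ b) = trans (⊕-·2+ _ _ p p) (cong₂ _·2+_ (go b) (ℙ.p+p≡0ℙ p))

⊕-comm : ∀ x y → x ⊕ y ≡ y ⊕ x
⊕-comm x y = go (bits x) (bits y)
  where
  go : ∀ {x y} → Bits x → Bits y → x ⊕ y ≡ y ⊕ x
  go {y = y} [] _  = trans (⊕-identityˡ y) (sym (⊕-identityʳ y))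
  go {x = x} _  [] = trans (⊕-identityʳ x) (sym (⊕-identityˡ x))
  go (p ∷ bx) (q ∷ by) = trans (⊕-·2+ _ _ p q)
    (trans (cong₂ _·2+_ (go bx by) (ℙ.+-comm p q)) (sym (⊕-·2+ _ _ q p)))

⊕-assoc : ∀ x y z → (x ⊕ y) ⊕ z ≡ x ⊕ (y ⊕ z)
⊕-assoc x y z = go (bits x) (bits y) (bits z)
  where
  go : ∀ {x y z} → Bits x → Bits y → Bits z → (x ⊕ y) ⊕ z ≡ x ⊕ (y ⊕ z)
  go {y = y} {z} [] _ _ = trans (cong (_⊕ z) (⊕-identityˡ y)) (sym (⊕-identityˡ (y ⊕ z)))
  go {x = x} {z = z} (_ ∷ _) [] _ =
    trans (cong (_⊕ z) (⊕-identityʳ x)) (cong (x ⊕_) (sym (⊕-identityˡ z)))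
  go {x = x} {y} (_ ∷ _) (_ ∷ _) [] =
    trans (⊕-identityʳ (x ⊕ y)) (cong (x ⊕_) (sym (⊕-identityʳ y)))
  go (_∷_ p {x} bx) (_∷_ q {y} by) (_∷_ r {z} bz) = begin
    ((x ·2+ p) ⊕ (y ·2+ q)) ⊕ (z ·2+ r)  ≡⟨ cong (_⊕ (z ·2+ r)) (⊕-·2+ x y p q) ⟩
    ((x ⊕ y) ·2+ (p ℙ.+ q)) ⊕ (z ·2+ r)  ≡⟨ ⊕-·2+ (x ⊕ y) z (p ℙ.+ q) r ⟩
    ((x ⊕ y) ⊕ z) ·2+ ((p ℙ.+ q) ℙ.+ r)  ≡⟨ cong₂ _·2+_ (go bx by bz) (ℙ.+-assoc p q r) ⟩
    (x ⊕ (y ⊕ z)) ·2+ (p ℙ.+ (q ℙ.+ r))  ≡⟨ sym (⊕-·2+ x (y ⊕ z) p (q ℙ.+ r)) ⟩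
    (x ·2+ p) ⊕ ((y ⊕ z) ·2+ (q ℙ.+ r))  ≡⟨ cong ((x ·2+ p) ⊕_) (sym (⊕-·2+ y z q r)) ⟩
    (x ·2+ p) ⊕ ((y ·2+ q) ⊕ (z ·2+ r))  ∎

⊕-isAbelianGroup : IsAbelianGroup _≡_ _⊕_ 0 id
⊕-isAbelianGroup = record
  { isGroup = record
    { isMonoid = record
      { isSemigroup = record
        { isMagma = record { isEquivalence = isEquivalence ; ∙-cong = cong₂ _⊕_ }
        ; assoc   = ⊕-assoc
        }
      ; identity = ⊕-identityˡ , ⊕-identityʳ
      }
    ; inverse = x⊕x≡0 , x⊕x≡0
    ; ⁻¹-cong = id
    }
  ; comm = ⊕-comm
  }

⊕-abelianGroup : AbelianGroup _ _
⊕-abelianGroup = record { isAbelianGroup = ⊕-isAbelianGroup }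

open CommutativeSemigroupProperties (AbelianGroup.commutativeSemigroup ⊕-abelianGroup)
  using () renaming (interchange to ⊕-interchange)

x⊕y≡0⇔x≡y : ∀ {x y} → x ⊕ y ≡ 0 ⇔ x ≡ y
x⊕y≡0⇔x≡y {x} {y} = mk⇔ (x∙y⁻¹≈ε⇒x≈y x y) x≈y⇒x∙y⁻¹≈ε
  where open GroupProperties (AbelianGroup.group ⊕-abelianGroup)

parity-⊕ : ∀ x y → parity (x ⊕ y) ≡ parity x ℙ.+ parity y
parity-⊕ x y = begin
  parity (x ⊕ y)
    ≡⟨ cong parity (sym (cong₂ _⊕_ x≡ y≡)) ⟩
  parity ((⌊ x /2⌋ ·2+ parity x) ⊕ (⌊ y /2⌋ ·2+ parity y))
    ≡⟨ cong parity (⊕-·2+ ⌊ x /2⌋ ⌊ y /2⌋ (parity x) (parity y)) ⟩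
  parity ((⌊ x /2⌋ ⊕ ⌊ y /2⌋) ·2+ (parity x ℙ.+ parity y))
    ≡⟨ parity-·2+ _ _ ⟩
  parity x ℙ.+ parity y ∎
  where
  x≡ = ⌊n/2⌋·2+parity≡n x
  y≡ = ⌊n/2⌋·2+parity≡n y

∑ : ℕ → (ℕ → ℕ) → ℕ
∑ zero    f = 0
∑ (suc n) f = f 0 + ∑ n (f ∘ suc)

∑-cong : ∀ n {f g : ℕ → ℕ} → (∀ {a} → a < n → f a ≡ g a) → ∑ n f ≡ ∑ n g
∑-cong zero    _   = refl
∑-cong (suc n) f≡g = cong₂ _+_ (f≡g (s≤s z≤n)) (∑-cong n (f≡g ∘ s≤s))

∑≡0 : ∀ n {f : ℕ → ℕ} → (∀ {a} → a < n → f a ≡ 0) → ∑ n f ≡ 0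
∑≡0 zero    _   = refl
∑≡0 (suc n) f≡0 = cong₂ _+_ (f≡0 (s≤s z≤n)) (∑≡0 n (f≡0 ∘ s≤s))

∑-distribˡ-* : ∀ n k (f : ℕ → ℕ) → ∑ n (λ a → k * f a) ≡ k * ∑ n f
∑-distribˡ-* zero    k f = sym (*-zeroʳ k)
∑-distribˡ-* (suc n) k f = trans (cong (k * f 0 +_) (∑-distribˡ-* n k (f ∘ suc)))
  (sym (*-distribˡ-+ k (f 0) (∑ n (f ∘ suc))))

∑-double : ∀ n (f : ℕ → ℕ) → ∑ (double n) f ≡ ∑ n (f ∘ double) + ∑ n (f ∘ suc ∘ double)
∑-double zero    f = refl
∑-double (suc n) f = trans (cong (λ s → f 0 + (f 1 + s)) (∑-double n (f ∘ suc ∘ suc)))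
  (trans (sym (+-assoc (f 0) (f 1) _)) (+-interchange (f 0) (f 1) _ _))

∑-suc-double : ∀ n (f : ℕ → ℕ) →
  ∑ (suc (double n)) f ≡ ∑ (suc n) (f ∘ double) + ∑ n (f ∘ suc ∘ double)
∑-suc-double n f = begin
  f 0 + ∑ (double n) (f ∘ suc)    ≡⟨ cong (f 0 +_) (∑-double n (f ∘ suc)) ⟩
  f 0 + (odds + evens)            ≡⟨ cong (f 0 +_) (+-comm odds evens) ⟩
  f 0 + (evens + odds)            ≡⟨ sym (+-assoc (f 0) evens odds) ⟩
  f 0 + evens + odds              ∎
  where
  odds  = ∑ n (f ∘ suc ∘ double)
  evens = ∑ n (f ∘ suc ∘ suc ∘ double)

[_] : {P : Set} → Dec P → ℕ
[ P? ] = if does P? then 1 else 0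

[]-⇔ : {P Q : Set} → P ⇔ Q → (P? : Dec P) (Q? : Dec Q) → [ P? ] ≡ [ Q? ]
[]-⇔ P⇔Q P? Q? = cong (λ b → if b then 1 else 0) (does-⇔ P⇔Q P? Q?)

length-filter-applyUpTo : ∀ {A : Set} {P : A → Set} (P? : Decidable P) (f : ℕ → A) n →
  length (filter P? (applyUpTo f n)) ≡ ∑ n (λ a → [ P? (f a) ])
length-filter-applyUpTo P? f zero = refl
length-filter-applyUpTo P? f (suc n) with does (P? (f 0))
... | true  = cong suc (length-filter-applyUpTo P? (f ∘ suc) n)
... | false = length-filter-applyUpTo P? (f ∘ suc) n

length-filter-cartesianProduct : ∀ {A B : Set} {P : A × B → Set} (P? : Decidable P)
  (f : ℕ → A) n (ys : List B) →
  length (filter P? (cartesianProduct (applyUpTo f n) ys))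
    ≡ ∑ n (λ a → length (filter P? (map (f a ,_) ys)))
length-filter-cartesianProduct P? f zero    ys = refl
length-filter-cartesianProduct P? f (suc n) ys =
  trans (cong length (filter-++ P? (map (f 0 ,_) ys) _))
    (trans (length-++ (filter P? (map (f 0 ,_) ys)))
      (cong (length (filter P? (map (f 0 ,_) ys)) +_) (length-filter-cartesianProduct P? (f ∘ suc) n ys)))

count : (ℕ → ℕ) → ℕ → ℕ → ℕ
count u n x = ∑ n (λ a → [ x ≟ u a ])

count-cong : ∀ u v n x → (∀ {a} → a < n → u a ≡ v a) → count u n x ≡ count v n x
count-cong u v n x u≡v = ∑-cong n (λ a<n → cong (λ y → [ x ≟ y ]) (u≡v a<n))

count-injective : ∀ {f} → Injective _≡_ _≡_ f → ∀ u n x → count (f ∘ u) n (f x) ≡ count u n x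
count-injective {f} f-inj u n x =
  ∑-cong n (λ {a} _ → []-⇔ (mk⇔ f-inj (cong f)) (f x ≟ f (u a)) (x ≟ u a))

count≡0 : ∀ u n x → (∀ {a} → a < n → u a ≢ x) → count u n x ≡ 0
count≡0 u n x ≢x =
  ∑≡0 n (λ {a} a<n → cong (λ b → if b then 1 else 0) (dec-false (x ≟ u a) (≢x a<n ∘ sym)))

double-injective : Injective _≡_ _≡_ double
double-injective {zero}  {zero}  _  = refl
double-injective {suc m} {suc n} eq = cong suc (double-injective (suc-injective (suc-injective eq)))

-- The value of row a + 1, i.e. (i - 1) ⊕ (m - i) for i = a + 1.
nimValue : ℕ → ℕ → ℕ
nimValue m a = a ⊕ (m ∸ suc a)

IsP⇔nimValue≡ : ∀ m a c → IsP m (suc a , suc c) ⇔ nimValue m a ≡ nimValue m c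
IsP⇔nimValue≡ m a c =
  mk⇔ (Equivalence.to x⊕y≡0⇔x≡y ∘ trans (sym regroup)) (trans regroup ∘ Equivalence.from x⊕y≡0⇔x≡y)
  where
  regroup : a ⊕ c ⊕ (m ∸ suc a) ⊕ (m ∸ suc c) ≡ nimValue m a ⊕ nimValue m c
  regroup = trans (⊕-assoc (a ⊕ c) _ _) (⊕-interchange a c _ _)

parity-nimValue : ∀ {m a} → a < m → parity (nimValue m a) ≡ parity m ⁻¹
parity-nimValue {suc m} {a} (s≤s a≤m) = begin
  parity (a ⊕ (m ∸ a))              ≡⟨ parity-⊕ a (m ∸ a) ⟩
  parity a ℙ.+ parity (m ∸ a)       ≡⟨ sym (ℙ.+-homo-+ a (m ∸ a)) ⟩
  parity (a + (m ∸ a))              ≡⟨ cong parity (m+[n∸m]≡n a≤m) ⟩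
  parity m                          ≡⟨ sym (ℙ.suc-homo-⁻¹ m) ⟩
  parity (suc m) ⁻¹                 ∎

nimValue-2m-2a : ∀ {m a} → a < m → nimValue (double m) (double a) ≡ suc (double (nimValue m a))
nimValue-2m-2a {m} {a} a<m = trans (cong (double a ⊕_) (double-∸-suc a<m)) (⊕-·2+ a (m ∸ suc a) 0ℙ 1ℙ)

nimValue-2m-2a+1 : ∀ m a → nimValue (double m) (suc (double a)) ≡ suc (double (nimValue m a))
nimValue-2m-2a+1 m a = trans (cong (suc (double a) ⊕_) (double-∸ m (suc a))) (⊕-·2+ a (m ∸ suc a) 1ℙ 0ℙ)

nimValue-2m+1-2a : ∀ m a → nimValue (suc (double m)) (double a) ≡ double (nimValue (suc m) a)
nimValue-2m+1-2a m a = trans (cong (double a ⊕_) (double-∸ m a)) (⊕-·2+ a (m ∸ a) 0ℙ 0ℙ)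

nimValue-2m+1-2a+1 : ∀ {m a} → a < m → nimValue (suc (double m)) (suc (double a)) ≡ double (nimValue m a)
nimValue-2m+1-2a+1 {m} {a} a<m =
  trans (cong (suc (double a) ⊕_) (double-∸-suc a<m)) (⊕-·2+ a (m ∸ suc a) 1ℙ 1ℙ)

count-nimValue-double : ∀ m x →
  count (nimValue (double m)) (double m) (suc (double x)) ≡ 2 * count (nimValue m) m x
count-nimValue-double m x = begin
  count v₂ (double m) 2x+1
    ≡⟨ ∑-double m _ ⟩
  count (v₂ ∘ double) m 2x+1 + count (v₂ ∘ suc ∘ double) m 2x+1
    ≡⟨ cong₂ _+_ (count-cong _ (suc ∘ double ∘ v) m 2x+1 nimValue-2m-2a)
                 (count-cong _ (suc ∘ double ∘ v) m 2x+1 (λ {a} _ → nimValue-2m-2a+1 m a)) ⟩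
  count (suc ∘ double ∘ v) m 2x+1 + count (suc ∘ double ∘ v) m 2x+1
    ≡⟨ cong₂ _+_ forget-suc-double forget-suc-double ⟩
  count v m x + count v m x
    ≡⟨ cong (count v m x +_) (sym (+-identityʳ (count v m x))) ⟩
  2 * count v m x ∎
  where
  v   = nimValue m
  v₂  = nimValue (double m)
  2x+1 = suc (double x)
  forget-suc-double : count (suc ∘ double ∘ v) m 2x+1 ≡ count v m x
  forget-suc-double = count-injective (double-injective ∘ suc-injective) v m x

count-nimValue-suc-double : ∀ m x →
  count (nimValue (suc (double m))) (suc (double m)) (double x)
    ≡ count (nimValue (suc m)) (suc m) x + count (nimValue m) m x
count-nimValue-suc-double m x = begin
  count v′ (suc (double m)) (double x)
    ≡⟨ ∑-suc-double m (λ a → [ double x ≟ v′ a ]) ⟩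
  count (v′ ∘ double) (suc m) (double x) + count (v′ ∘ suc ∘ double) m (double x)
    ≡⟨ cong₂ _+_ (count-cong _ (double ∘ nimValue (suc m)) (suc m) (double x) (λ {a} _ → nimValue-2m+1-2a m a))
                 (count-cong _ (double ∘ nimValue m) m (double x) nimValue-2m+1-2a+1) ⟩
  count (double ∘ nimValue (suc m)) (suc m) (double x) + count (double ∘ nimValue m) m (double x)
    ≡⟨ cong₂ _+_ (count-injective double-injective (nimValue (suc m)) (suc m) x)
                 (count-injective double-injective (nimValue m) m x) ⟩
  count (nimValue (suc m)) (suc m) x + count (nimValue m) m x ∎
  where
  v′ = nimValue (suc (double m))

count-nimValue-wrong-parity : ∀ m x → parity x ≡ parity m → count (nimValue m) m x ≡ 0
count-nimValue-wrong-parity m x px≡pm = count≡0 (nimValue m) m x (λ a<m e →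
  ℙ.p≢p⁻¹ (parity m) (trans (sym px≡pm) (trans (cong parity (sym e)) (parity-nimValue a<m))))

equalNimPairs : ℕ → ℕ
equalNimPairs m = ∑ m (λ a → count (nimValue m) m (nimValue m a))

equalNimPairs-double : ∀ m → equalNimPairs (double m) ≡ 4 * equalNimPairs m
equalNimPairs-double m = begin
  ∑ (double m) (λ a → count v₂ (double m) (v₂ a))
    ≡⟨ ∑-double m (λ a → count v₂ (double m) (v₂ a)) ⟩
  ∑ m (λ a → count v₂ (double m) (v₂ (double a))) + ∑ m (λ a → count v₂ (double m) (v₂ (suc (double a))))
    ≡⟨ cong₂ _+_ (∑-cong m (λ {a} a<m → via a (double a) (nimValue-2m-2a a<m)))
                 (∑-cong m (λ {a} _ → via a (suc (double a)) (nimValue-2m-2a+1 m a))) ⟩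
  ∑ m (λ a → 2 * count v m (v a)) + ∑ m (λ a → 2 * count v m (v a))
    ≡⟨ cong₂ _+_ (∑-distribˡ-* m 2 (λ a → count v m (v a))) (∑-distribˡ-* m 2 (λ a → count v m (v a))) ⟩
  2 * equalNimPairs m + 2 * equalNimPairs m
    ≡⟨ sym (*-distribʳ-+ (equalNimPairs m) 2 2) ⟩
  4 * equalNimPairs m ∎
  where
  v  = nimValue m
  v₂ = nimValue (double m)
  via : ∀ a b → v₂ b ≡ suc (double (v a)) → count v₂ (double m) (v₂ b) ≡ 2 * count v m (v a)
  via a b eq = trans (cong (count v₂ (double m)) eq) (count-nimValue-double m (v a))

equalNimPairs-suc-double : ∀ m → equalNimPairs (suc (double m)) ≡ equalNimPairs (suc m) + equalNimPairs m
equalNimPairs-suc-double m = begin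
  ∑ (suc (double m)) (λ a → count v′ (suc (double m)) (v′ a))
    ≡⟨ ∑-suc-double m (λ a → count v′ (suc (double m)) (v′ a)) ⟩
  ∑ (suc m) (λ a → count v′ (suc (double m)) (v′ (double a)))
    + ∑ m (λ a → count v′ (suc (double m)) (v′ (suc (double a))))
    ≡⟨ cong₂ _+_
         (∑-cong (suc m) (λ {a} a<1+m →
           trans (via (v₊ a) (double a) (nimValue-2m+1-2a m a)) (cross₁ a a<1+m)))
         (∑-cong m (λ {a} a<m →
           trans (via (v a) (suc (double a)) (nimValue-2m+1-2a+1 a<m)) (cross₂ a a<m))) ⟩
  equalNimPairs (suc m) + equalNimPairs m ∎
  where
  v  = nimValue m
  v₊ = nimValue (suc m)
  v′ = nimValue (suc (double m))
  via : ∀ x b → v′ b ≡ double x → count v′ (suc (double m)) (v′ b) ≡ count v₊ (suc m) x + count v m x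
  via x b eq = trans (cong (count v′ (suc (double m))) eq) (count-nimValue-suc-double m x)
  cross₁ : ∀ a → a < suc m → count v₊ (suc m) (v₊ a) + count v m (v₊ a) ≡ count v₊ (suc m) (v₊ a)
  cross₁ a a<1+m = trans (cong (count v₊ (suc m) (v₊ a) +_) (count-nimValue-wrong-parity m (v₊ a)
    (trans (parity-nimValue a<1+m) (ℙ.suc-homo-⁻¹ m)))) (+-identityʳ _)
  cross₂ : ∀ a → a < m → count v₊ (suc m) (v a) + count v m (v a) ≡ count v m (v a)
  cross₂ a a<m = cong (_+ count v m (v a)) (count-nimValue-wrong-parity (suc m) (v a)
    (trans (parity-nimValue a<m) (ℙ.suc-homo-⁻¹ (suc m))))

g≡equalNimPairs : ∀ m → g m ≡ equalNimPairs m
g≡equalNimPairs m = begin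
  g m
    ≡⟨ cong (λ L → length (filter (IsP? m) (cartesianProduct L L))) (map-applyUpTo id suc m) ⟩
  length (filter (IsP? m) (cartesianProduct (applyUpTo suc m) (applyUpTo suc m)))
    ≡⟨ length-filter-cartesianProduct (IsP? m) suc m (applyUpTo suc m) ⟩
  ∑ m (λ a → length (filter (IsP? m) (map (suc a ,_) (applyUpTo suc m))))
    ≡⟨ ∑-cong m (λ {a} _ → row a) ⟩
  equalNimPairs m ∎
  where
  row : ∀ a → length (filter (IsP? m) (map (suc a ,_) (applyUpTo suc m))) ≡ count (nimValue m) m (nimValue m a)
  row a = begin
    length (filter (IsP? m) (map (suc a ,_) (applyUpTo suc m)))
      ≡⟨ cong (length ∘ filter (IsP? m)) (map-applyUpTo suc (suc a ,_) m) ⟩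
    length (filter (IsP? m) (applyUpTo (λ c → suc a , suc c) m))
      ≡⟨ length-filter-applyUpTo (IsP? m) (λ c → suc a , suc c) m ⟩
    ∑ m (λ c → [ IsP? m (suc a , suc c) ])
      ≡⟨ ∑-cong m (λ {c} _ →
           []-⇔ (IsP⇔nimValue≡ m a c) (IsP? m (suc a , suc c)) (nimValue m a ≟ nimValue m c)) ⟩
    count (nimValue m) m (nimValue m a) ∎

lemma1 : (m : ℕ) → 1 Data.Nat.≤ m →
    (g (2 * m) ≡ 4 * g m) × (g (2 * m + 1) ≡ g m + g (m + 1))
lemma1 m _ = g-even , g-odd
  where
  g-even : g (2 * m) ≡ 4 * g m
  g-even = begin
    g (2 * m)                   ≡⟨ cong g (sym (double≡2* m)) ⟩
    g (double m)                ≡⟨ g≡equalNimPairs (double m) ⟩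
    equalNimPairs (double m)    ≡⟨ equalNimPairs-double m ⟩
    4 * equalNimPairs m         ≡⟨ cong (4 *_) (sym (g≡equalNimPairs m)) ⟩
    4 * g m                     ∎
  g-odd : g (2 * m + 1) ≡ g m + g (m + 1)
  g-odd = begin
    g (2 * m + 1)
      ≡⟨ cong g (trans (+-comm (2 * m) 1) (cong suc (sym (double≡2* m)))) ⟩
    g (suc (double m))
      ≡⟨ g≡equalNimPairs (suc (double m)) ⟩
    equalNimPairs (suc (double m))
      ≡⟨ equalNimPairs-suc-double m ⟩
    equalNimPairs (suc m) + equalNimPairs m
      ≡⟨ +-comm (equalNimPairs (suc m)) (equalNimPairs m) ⟩
    equalNimPairs m + equalNimPairs (suc m)
      ≡⟨ sym (cong₂ _+_ (g≡equalNimPairs m) (g≡equalNimPairs (suc m))) ⟩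
    g m + g (suc m)
      ≡⟨ cong (λ n → g m + g n) (+-comm 1 m) ⟩
    g m + g (m + 1) ∎
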